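{- Let $m$ be a positive integer. If there exists a symmetric 2-$(4m - 1, 2m - 1, m - 1)$ design, then there exists a resolvable $((4m - 1) \times 4m,\ 8m - 2)$-unordered triple array.
   Context: A 2-$(v,k,\lambda)$ design is a collection of $k$-subsets (blocks) of a $v$-set such that each pair of distinct points lies in exactly $\lambda$ blocks; it is symmetric if it has exactly $v$ blocks. An $(r \times c, v)$-unordered triple array on a set $V$ of $v$ symbols is a collection of $c$-subsets $R_1, \dots, R_r \subseteq V$ (row-sets) and $r$-subsets $C_1, \dots, C_c \subseteq V$ (column-sets) such that, for some integers $e, \lambda_{rc}, \lambda_{rr}, \lambda_{cc}$, each symbol lies in exactly $e$ row-sets and exactly $e$ column-sets, $|R_i \cap C_j| = \lambda_{rc}$ for all $i,j$, $|R_i \cap R_s| = \lambda_{rr}$ for all $i \neq s$, and $|C_j \cap C_t| = \lambda_{cc}$ for all $j \neq t$. Necessarily $e = rc/v$. Such an unordered triple array is called resolvable if $\lambda_{rrc} := \frac{e(e-1)}{r-1}$ and $k := \frac{c}{e}$ are integers and the symbol set can be partitioned into $r$ groups of size $k$ such that every column-set contains exactly one symbol from each group, and all symbols of a group lie in exactly the same row-sets. -}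

module Defs where

open import Data.Nat using (ℕ; _*_; _∸_)
open import Data.Nat.Divisibility using (_∣_)
open import Data.Bool using (Bool; true; _∧_)
open import Data.Fin using (Fin; _≟_)
open import Data.Fin.Subset using (Subset; ∣_∣; _∩_)
open import Data.Vec using (lookup; tabulate)
open import Data.Product using (Σ; _×_)
open import Relation.Nullary using (¬_)
open import Relation.Nullary.Decidable using (⌊_⌋)
open import Relation.Binary.PropositionalEquality using (_≡_)

count : ∀ {n} → (Fin n → Bool) → ℕ
count f = ∣ tabulate f ∣

_∈ˢ_ : ∀ {n} → Fin n → Subset n → Bool
x ∈ˢ p = lookup p x

-- A 2-(v,k,λ) design on the point set Fin v with b blocks
-- (blocks given as an indexed family, so repeated blocks are allowed).
record Design (v b k lam : ℕ) : Set where
  field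
    block      : Fin b → Subset v
    block-size : ∀ i → ∣ block i ∣ ≡ k
    pair-count : ∀ x y → ¬ x ≡ y →
                 count (λ i → (x ∈ˢ block i) ∧ (y ∈ˢ block i)) ≡ lam

SymmetricDesign : ℕ → ℕ → ℕ → Set
SymmetricDesign v k lam = Design v v k lam

record UnorderedTripleArray (r c v : ℕ) : Set where
  field
    rowSet   : Fin r → Subset v
    colSet   : Fin c → Subset v
    row-size : ∀ i → ∣ rowSet i ∣ ≡ c
    col-size : ∀ j → ∣ colSet j ∣ ≡ r
    e λrc λrr λcc : ℕ
    row-rep  : ∀ x → count (λ i → x ∈ˢ rowSet i) ≡ e
    col-rep  : ∀ x → count (λ j → x ∈ˢ colSet j) ≡ e
    rc-int   : ∀ i j → ∣ rowSet i ∩ colSet j ∣ ≡ λrc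
    rr-int   : ∀ i s → ¬ i ≡ s → ∣ rowSet i ∩ rowSet s ∣ ≡ λrr
    cc-int   : ∀ j t → ¬ j ≡ t → ∣ colSet j ∩ colSet t ∣ ≡ λcc

-- Resolvability: λrrc = e(e-1)/(r-1) and k = c/e are integers, and there is a
-- partition of the symbols into r groups (group : Fin v → Fin r) each of size k,
-- every column-set meets every group in exactly one symbol, and symbols in the
-- same group lie in exactly the same row-sets.
record Resolvable {r c v : ℕ} (U : UnorderedTripleArray r c v) : Set where
  open UnorderedTripleArray U
  field
    λrrc-integer : (r ∸ 1) ∣ (e * (e ∸ 1))
    k            : ℕ
    k-def        : k * e ≡ c
    group        : Fin v → Fin r
    group-size   : ∀ a → count (λ x → ⌊ group x ≟ a ⌋) ≡ k
    col-transversal : ∀ j a →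
                 count (λ x → (x ∈ˢ colSet j) ∧ ⌊ group x ≟ a ⌋) ≡ 1
    group-rows   : ∀ x y → group x ≡ group y →
                 ∀ i → x ∈ˢ rowSet i ≡ y ∈ˢ rowSet i

{-# OPTIONS --safe #-}
-- Write m = n + 1 and let B_1, …, B_v be the blocks of a symmetric
-- 2-(4n+3, 2n+1, n) design. The symbols are the pairs (i, b) of a block and a
-- bit, the rows are the points y with R_y = {(i, b) : y ∉ B_i}, and the columns
-- are the points together with one extra column ∞, where
-- C_∞ = {(i, true)} and C_y = {(i, true) : y ∈ B_i} ∪ {(i, false) : y ∉ B_i}.
-- Every size and intersection is then a count of blocks through or avoiding
-- one or two points, fixed by the parameters once every point is known to lie
-- on k = 2n+1 blocks; that follows from double counting r·k = r + λ(v−1) as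
-- soon as λ ≥ 1. The groups of the resolution are the pairs {(i, true), (i, false)}.
module Submission where

open import Defs
open import Data.Nat using (ℕ; zero; suc; _+_; _*_; _∸_; _≤_)
open import Data.Nat.Properties
  using (+-*-semiring; +-identityʳ; *-identityʳ; +-cancelˡ-≡; *-cancelˡ-≡)
open import Data.Nat.Divisibility using (divides)
open import Data.Nat.Tactic.RingSolver using (solve)
open import Data.List using (_∷_; [])
open import Data.Bool using (Bool; true; false; _∧_; not)
open import Data.Bool.Properties using (∧-comm; ∧-idem)
open import Data.Fin using (Fin; zero; suc; _≟_; _↑ˡ_; _↑ʳ_; splitAt; punchIn)
open import Data.Fin.Properties using (splitAt-↑ˡ; splitAt-↑ʳ; punchInᵢ≢i)
open import Data.Fin.Subset using (Subset; ∣_∣; _∩_; ⁅_⁆)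
open import Data.Fin.Subset.Properties using (∣⁅x⁆∣≡1)
open import Data.Vec using (tabulate)
open import Data.Vec.Properties
  using (lookup∘tabulate; tabulate∘lookup; tabulate-cong; lookup-replicate)
open import Data.Product using (Σ; Σ-syntax; _×_; _,_; proj₁; proj₂)
open import Data.Sum using ([_,_]′)
open import Function using (_∘_; _∋_)
open import Relation.Nullary using (yes; no; contradiction)
open import Relation.Nullary.Decidable using (⌊_⌋; ⌊⌋-map′)
open import Relation.Binary.PropositionalEquality
  using (_≡_; _≢_; _≗_; refl; sym; trans; cong; cong₂; subst₂; module ≡-Reasoning)

open import Algebra.Properties.Semiring.Sum +-*-semiring
  using (sum-syntax; sum-cong-≗; sum-remove; ∑-distrib-+; ∑-comm; *-distribˡ-sum; *-distribʳ-sum)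

open ≡-Reasoning

indicator : Bool → ℕ
indicator true  = 1
indicator false = 0

indicator-∧ : ∀ a b → indicator (a ∧ b) ≡ indicator a * indicator b
indicator-∧ true  true  = refl
indicator-∧ true  false = refl
indicator-∧ false b     = refl

indicator-split : ∀ a b → indicator a ≡ indicator (a ∧ b) + indicator (a ∧ not b)
indicator-split true  true  = refl
indicator-split true  false = refl
indicator-split false b     = refl

indicator-complement : ∀ a → indicator a + indicator (not a) ≡ 1
indicator-complement true  = refl
indicator-complement false = refl

∑-const : ∀ n c → ∑[ i < n ] c ≡ n * c
∑-const zero    c = refl
∑-const (suc n) c = cong (c +_) (∑-const n c)

∑-except : ∀ {N} (f : Fin (suc N) → ℕ) y {c} → (∀ x → x ≢ y → f x ≡ c) →
           ∑[ x < suc N ] f x ≡ f y + N * c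
∑-except {N} f y {c} f≡c = begin
  ∑[ x < suc N ] f x                ≡⟨ sum-remove {i = y} f ⟩
  f y + ∑[ x < N ] f (punchIn y x)  ≡⟨ cong (f y +_) (sum-cong-≗ (f≡c _ ∘ punchInᵢ≢i y)) ⟩
  f y + ∑[ x < N ] c                ≡⟨ cong (f y +_) (∑-const N c) ⟩
  f y + N * c                       ∎

count-∑ : ∀ {n} (f : Fin n → Bool) → count f ≡ ∑[ i < n ] indicator (f i)
count-∑ {zero}  f = refl
count-∑ {suc n} f with f zero
... | true  = cong suc (count-∑ (f ∘ suc))
... | false = count-∑ (f ∘ suc)

count-cong : ∀ {n} {f g : Fin n → Bool} → f ≗ g → count f ≡ count g
count-cong f≗g = cong ∣_∣ (tabulate-cong f≗g)

count-∈ˢ : ∀ {n} (p : Subset n) → count (_∈ˢ p) ≡ ∣ p ∣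
count-∈ˢ p = cong ∣_∣ (tabulate∘lookup p)

count-false : ∀ n → count {n} (λ _ → false) ≡ 0
count-false zero    = refl
count-false (suc n) = count-false n

count-≟ : ∀ {n} (a : Fin n) → count (λ i → ⌊ i ≟ a ⌋) ≡ 1
count-≟ {suc n} zero    = cong suc (count-false n)
count-≟ {suc n} (suc a) = trans (count-cong (λ i → ⌊⌋-map′ _ _ (i ≟ a))) (count-≟ a)

count-+ : ∀ {a b} (f : Fin (a + b) → Bool) →
          count f ≡ count (λ i → f (i ↑ˡ b)) + count (λ i → f (a ↑ʳ i))
count-+ {zero}  f = refl
count-+ {suc a} {b} f with f zero
... | true  = cong suc (count-+ {a} {b} (f ∘ suc))
... | false = count-+ {a} {b} (f ∘ suc)

count-split : ∀ {n} (f g : Fin n → Bool) →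
              count f ≡ count (λ i → f i ∧ g i) + count (λ i → f i ∧ not (g i))
count-split {n} f g = begin
  count f
    ≡⟨ count-∑ f ⟩
  ∑[ i < n ] indicator (f i)
    ≡⟨ sum-cong-≗ (λ i → indicator-split (f i) (g i)) ⟩
  ∑[ i < n ] (indicator (f∧g i) + indicator (f∧¬g i))
    ≡⟨ ∑-distrib-+ (indicator ∘ f∧g) (indicator ∘ f∧¬g) ⟩
  ∑[ i < n ] indicator (f∧g i) + ∑[ i < n ] indicator (f∧¬g i)
    ≡⟨ cong₂ _+_ (count-∑ f∧g) (count-∑ f∧¬g) ⟨
  count f∧g + count f∧¬g
    ∎
  where
  f∧g f∧¬g : Fin n → Bool
  f∧g  i = f i ∧ g i
  f∧¬g i = f i ∧ not (g i)

count-complement : ∀ {n} (f : Fin n → Bool) → count f + count (not ∘ f) ≡ n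
count-complement {n} f = begin
  count f + count (not ∘ f)
    ≡⟨ cong₂ _+_ (count-∑ f) (count-∑ (not ∘ f)) ⟩
  ∑[ i < n ] indicator (f i) + ∑[ i < n ] indicator (not (f i))
    ≡⟨ ∑-distrib-+ (indicator ∘ f) (indicator ∘ not ∘ f) ⟨
  ∑[ i < n ] (indicator (f i) + indicator (not (f i)))
    ≡⟨ sum-cong-≗ (indicator-complement ∘ f) ⟩
  ∑[ i < n ] 1
    ≡⟨ ∑-const n 1 ⟩
  n * 1
    ≡⟨ *-identityʳ n ⟩
  n ∎

count-not : ∀ {n a b} (f : Fin n → Bool) → count f ≡ a → a + b ≡ n → count (not ∘ f) ≡ b
count-not {n} {a} {b} f count-f a+b≡n = +-cancelˡ-≡ a _ _ (begin
  a + count (not ∘ f)        ≡⟨ cong (_+ count (not ∘ f)) count-f ⟨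
  count f + count (not ∘ f)  ≡⟨ count-complement f ⟩
  n                          ≡⟨ a+b≡n ⟨
  a + b                      ∎)

count-∧-not : ∀ {n a b c} (f g : Fin n → Bool) →
              count f ≡ a → count (λ i → f i ∧ g i) ≡ b → b + c ≡ a →
              count (λ i → f i ∧ not (g i)) ≡ c
count-∧-not {a = a} {b} {c} f g count-f count-f∧g b+c≡a = +-cancelˡ-≡ b _ _ (begin
  b + count (λ i → f i ∧ not (g i))                        ≡⟨ cong (_+ _) count-f∧g ⟨
  count (λ i → f i ∧ g i) + count (λ i → f i ∧ not (g i))  ≡⟨ count-split f g ⟨
  count f                                                  ≡⟨ count-f ⟩
  a                                                        ≡⟨ b+c≡a ⟨
  b + c                                                    ∎)

∣tabulate∩tabulate∣ : ∀ {n} (f g : Fin n → Bool) →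
                      ∣ tabulate f ∩ tabulate g ∣ ≡ count (λ i → f i ∧ g i)
∣tabulate∩tabulate∣ {zero}  f g = refl
∣tabulate∩tabulate∣ {suc n} f g with f zero ∧ g zero
... | true  = cong suc (∣tabulate∩tabulate∣ (f ∘ suc) (g ∘ suc))
... | false = ∣tabulate∩tabulate∣ (f ∘ suc) (g ∘ suc)

pairing : ∀ a → Fin (a + a) → Fin a × Bool
pairing a s = [ (_, true) , (_, false) ]′ (splitAt a s)

count-pairing : ∀ {a} (F : Fin a × Bool → Bool) →
                count (F ∘ pairing a) ≡ count (λ i → F (i , true)) + count (λ i → F (i , false))
count-pairing {a} F =
  trans (count-+ {a} {a} (F ∘ pairing a)) (cong₂ _+_ (count-cong left) (count-cong right))
  where
  left : ∀ i → F (pairing a (i ↑ˡ a)) ≡ F (i , true)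
  left i = cong (F ∘ [ (_, true) , (_, false) ]′) (splitAt-↑ˡ a i a)
  right : ∀ i → F (pairing a (a ↑ʳ i)) ≡ F (i , false)
  right i = cong (F ∘ [ (_, true) , (_, false) ]′) (splitAt-↑ʳ a a i)

replication : ∀ {v b k lam} → Design v b k lam → Fin v → ℕ
replication D y = count (λ i → y ∈ˢ Design.block D i)

block-count : ∀ {v b k lam} (D : Design v b k lam) i → count (_∈ˢ Design.block D i) ≡ k
block-count D i = trans (count-∈ˢ (Design.block D i)) (Design.block-size D i)

replication-double-count : ∀ {N b k lam} (D : Design (suc N) b k lam) y →
                           k * replication D y ≡ replication D y + N * lam
replication-double-count {N} {b} {k} {lam} D y = begin
  k * count (y ∈B_)
    ≡⟨ cong (k *_) (count-∑ (y ∈B_)) ⟩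
  k * ∑[ i < b ] indicator (y ∈B i)
    ≡⟨ *-distribˡ-sum k (indicator ∘ (y ∈B_)) ⟩
  ∑[ i < b ] (k * indicator (y ∈B i))
    ≡⟨ sum-cong-≗ points-of-block ⟨
  ∑[ i < b ] ∑[ x < suc N ] indicator (x ∈B i ∧ y ∈B i)
    ≡⟨ ∑-comm (λ i x → indicator (x ∈B i ∧ y ∈B i)) ⟩
  ∑[ x < suc N ] ∑[ i < b ] indicator (x ∈B i ∧ y ∈B i)
    ≡⟨ sum-cong-≗ (λ x → count-∑ (λ i → x ∈B i ∧ y ∈B i)) ⟨
  ∑[ x < suc N ] count (λ i → x ∈B i ∧ y ∈B i)
    ≡⟨ ∑-except _ y (λ x → pair-count x y) ⟩
  count (λ i → y ∈B i ∧ y ∈B i) + N * lam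
    ≡⟨ cong (_+ N * lam) (count-cong (λ i → ∧-idem (y ∈B i))) ⟩
  count (y ∈B_) + N * lam
    ∎
  where
  open Design D
  _∈B_ : Fin (suc N) → Fin b → Bool
  x ∈B i = x ∈ˢ block i
  points-of-block : ∀ i → ∑[ x < suc N ] indicator (x ∈B i ∧ y ∈B i) ≡ k * indicator (y ∈B i)
  points-of-block i = begin
    ∑[ x < suc N ] indicator (x ∈B i ∧ y ∈B i)
      ≡⟨ sum-cong-≗ (λ x → indicator-∧ (x ∈B i) (y ∈B i)) ⟩
    ∑[ x < suc N ] (indicator (x ∈B i) * indicator (y ∈B i))
      ≡⟨ *-distribʳ-sum (indicator (y ∈B i)) (indicator ∘ (_∈B i)) ⟨
    ∑[ x < suc N ] indicator (x ∈B i) * indicator (y ∈B i)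
      ≡⟨ cong (_* indicator (y ∈B i)) (trans (sym (count-∑ (_∈B i))) (block-count D i)) ⟩
    k * indicator (y ∈B i)
      ∎

replication-hadamard : ∀ {n b} (D : Design (3 + 4 * suc n) b (1 + 2 * suc n) (suc n)) y →
                       replication D y ≡ 1 + 2 * suc n
replication-hadamard {n} D y = *-cancelˡ-≡ r (1 + 2 * N) (2 * N) (+-cancelˡ-≡ r _ _ (begin
  r + 2 * N * r            ≡⟨ replication-double-count D y ⟩
  r + (2 + 4 * N) * N      ≡⟨ cong (r +_) [2+4N]N≡2N[1+2N] ⟩
  r + 2 * N * (1 + 2 * N)  ∎))
  where
  N r : ℕ
  N = suc n
  r = replication D y
  [2+4N]N≡2N[1+2N] : (2 + 4 * suc n) * suc n ≡ 2 * suc n * (1 + 2 * suc n)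
  [2+4N]N≡2N[1+2N] = solve (n ∷ [])

x∈ˢ⁅i⁆≡⌊i≟x⌋ : ∀ {n} (i x : Fin n) → x ∈ˢ ⁅ i ⁆ ≡ ⌊ i ≟ x ⌋
x∈ˢ⁅i⁆≡⌊i≟x⌋ zero    zero    = refl
x∈ˢ⁅i⁆≡⌊i≟x⌋ zero    (suc x) = lookup-replicate x false
x∈ˢ⁅i⁆≡⌊i≟x⌋ (suc i) zero    = refl
x∈ˢ⁅i⁆≡⌊i≟x⌋ (suc i) (suc x) = trans (x∈ˢ⁅i⁆≡⌊i≟x⌋ i x) (sym (⌊⌋-map′ _ _ (i ≟ x)))

singletonDesign : ∀ v → Design v v 1 0
singletonDesign v = record
  { block      = ⁅_⁆
  ; block-size = ∣⁅x⁆∣≡1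
  ; pair-count = λ x y x≢y → trans (count-cong (disjoint x y x≢y)) (count-false v)
  }
  where
  disjoint : ∀ x y → x ≢ y → ∀ i → x ∈ˢ ⁅ i ⁆ ∧ y ∈ˢ ⁅ i ⁆ ≡ false
  disjoint x y x≢y i rewrite x∈ˢ⁅i⁆≡⌊i≟x⌋ i x | x∈ˢ⁅i⁆≡⌊i≟x⌋ i y with i ≟ x | i ≟ y
  ... | yes refl | yes refl = contradiction refl x≢y
  ... | yes _    | no _     = refl
  ... | no _     | _        = refl

replication-singleton : ∀ {v} y → replication (singletonDesign v) y ≡ 1
replication-singleton y = trans (count-cong (λ i → x∈ˢ⁅i⁆≡⌊i≟x⌋ i y)) (count-≟ y)

module HadamardConstruction
  (n : ℕ) (D : Design (3 + 4 * n) (3 + 4 * n) (1 + 2 * n) n)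
  (replication≡k : ∀ y → replication D y ≡ 1 + 2 * n) where

  open Design D

  v k e : ℕ
  v = 3 + 4 * n
  k = 1 + 2 * n
  e = 2 + 2 * n

  k+e≡v : (1 + 2 * n) + (2 + 2 * n) ≡ 3 + 4 * n
  k+e≡v = solve (n ∷ [])

  λ+[λ+1]≡k : n + (1 + n) ≡ 1 + 2 * n
  λ+[λ+1]≡k = solve (n ∷ [])

  [λ+1]+[λ+1]≡e : (1 + n) + (1 + n) ≡ 2 + 2 * n
  [λ+1]+[λ+1]≡e = solve (n ∷ [])

  e+e≡v+1 : (2 + 2 * n) + (2 + 2 * n) ≡ 4 + 4 * n
  e+e≡v+1 = solve (n ∷ [])

  2e≡v+1 : 2 * (2 + 2 * n) ≡ 4 + 4 * n
  2e≡v+1 = solve (n ∷ [])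

  e[e-1]≡[λ+1][v-1] : (2 + 2 * n) * (1 + 2 * n) ≡ (1 + n) * (2 + 4 * n)
  e[e-1]≡[λ+1][v-1] = solve (n ∷ [])

  _∈B_ _∉B_ : Fin v → Fin v → Bool
  y ∈B i = y ∈ˢ block i
  y ∉B i = not (y ∈B i)

  incidence : Fin (suc v) → Fin v → Bool
  incidence zero    i = true
  incidence (suc y) i = y ∈B i

  symbol : Fin (v + v) → Fin v × Bool
  symbol = pairing v

  group : Fin (v + v) → Fin v
  group = proj₁ ∘ symbol

  inRow : Fin v → Fin v × Bool → Bool
  inRow y (i , _) = y ∉B i

  inColumn : Fin (suc v) → Fin v × Bool → Bool
  inColumn j (i , true)  = incidence j i
  inColumn j (i , false) = not (incidence j i)

  blocks-avoiding : ∀ y → count (y ∉B_) ≡ e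
  blocks-avoiding y = count-not (y ∈B_) (replication≡k y) k+e≡v

  points-avoiding : ∀ i → count (_∉B i) ≡ e
  points-avoiding i = count-not (_∈B i) (block-count D i) k+e≡v

  blocks-through-avoiding : ∀ y z → z ≢ y → count (λ i → z ∈B i ∧ y ∉B i) ≡ 1 + n
  blocks-through-avoiding y z z≢y =
    count-∧-not (z ∈B_) (y ∈B_) (replication≡k z) (pair-count z y z≢y) λ+[λ+1]≡k

  blocks-avoiding-both : ∀ y z → y ≢ z → count (λ i → y ∉B i ∧ z ∉B i) ≡ 1 + n
  blocks-avoiding-both y z y≢z = count-∧-not (y ∉B_) (z ∈B_) (blocks-avoiding y)
    (trans (count-cong (λ i → ∧-comm (y ∉B i) (z ∈B i))) (blocks-through-avoiding y z (y≢z ∘ sym)))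
    [λ+1]+[λ+1]≡e

  columns-meet : ∀ j t → j ≢ t →
    count (λ i → incidence j i ∧ incidence t i) +
    count (λ i → not (incidence j i) ∧ not (incidence t i)) ≡ k
  columns-meet zero    zero    j≢t = contradiction refl j≢t
  columns-meet zero    (suc z) _   = trans (cong₂ _+_ (replication≡k z) (count-false v)) (+-identityʳ k)
  columns-meet (suc y) zero    j≢t = trans
    (cong₂ _+_ (count-cong (λ i → ∧-comm (y ∈B i) true))
               (count-cong (λ i → ∧-comm (y ∉B i) false)))
    (columns-meet zero (suc y) (j≢t ∘ sym))
  columns-meet (suc y) (suc z) j≢t = trans
    (cong₂ _+_ (pair-count y z (j≢t ∘ cong suc)) (blocks-avoiding-both y z (j≢t ∘ cong suc)))
    λ+[λ+1]≡k

  column-replication : ∀ x → count (λ j → inColumn j x) ≡ e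
  column-replication (i , true)  = cong suc (block-count D i)
  column-replication (i , false) = points-avoiding i

  symbols : (Fin v × Bool → Bool) → Subset (v + v)
  symbols F = tabulate (F ∘ symbol)

  ∣symbols∩symbols∣ : ∀ F G → ∣ symbols F ∩ symbols G ∣ ≡
    count (λ i → F (i , true) ∧ G (i , true)) + count (λ i → F (i , false) ∧ G (i , false))
  ∣symbols∩symbols∣ F G =
    trans (∣tabulate∩tabulate∣ (F ∘ symbol) (G ∘ symbol)) (count-pairing (λ x → F x ∧ G x))

  ∈ˢ-symbols : ∀ F s → s ∈ˢ symbols F ≡ F (symbol s)
  ∈ˢ-symbols F = lookup∘tabulate (F ∘ symbol)

  tripleArray : UnorderedTripleArray v (suc v) (v + v)
  tripleArray = record
    { rowSet   = symbols ∘ inRow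
    ; colSet   = symbols ∘ inColumn
    ; row-size = λ y → trans (count-pairing (inRow y))
                             (trans (cong₂ _+_ (blocks-avoiding y) (blocks-avoiding y)) e+e≡v+1)
    ; col-size = λ j → trans (count-pairing (inColumn j)) (count-complement (incidence j))
    ; e        = e
    ; λrc      = e
    ; λrr      = e
    ; λcc      = k
    ; row-rep  = λ s → trans (count-cong (λ y → ∈ˢ-symbols (inRow y) s)) (points-avoiding (group s))
    ; col-rep  = λ s → trans (count-cong (λ j → ∈ˢ-symbols (inColumn j) s)) (column-replication (symbol s))
    ; rc-int   = λ y j → trans (∣symbols∩symbols∣ (inRow y) (inColumn j))
                               (trans (sym (count-split (y ∉B_) (incidence j))) (blocks-avoiding y))
    ; rr-int   = λ y z y≢z → trans (∣symbols∩symbols∣ (inRow y) (inRow z))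
        (trans (cong₂ _+_ (blocks-avoiding-both y z y≢z) (blocks-avoiding-both y z y≢z)) [λ+1]+[λ+1]≡e)
    ; cc-int   = λ j t j≢t → trans (∣symbols∩symbols∣ (inColumn j) (inColumn t)) (columns-meet j t j≢t)
    }

  column-transversal : ∀ j a → count (λ s → s ∈ˢ symbols (inColumn j) ∧ ⌊ group s ≟ a ⌋) ≡ 1
  column-transversal j a = begin
    count (λ s → s ∈ˢ symbols (inColumn j) ∧ ⌊ group s ≟ a ⌋)
      ≡⟨ count-cong (λ s → cong (_∧ ⌊ group s ≟ a ⌋) (∈ˢ-symbols (inColumn j) s)) ⟩
    count (λ s → inColumn j (symbol s) ∧ ⌊ group s ≟ a ⌋)
      ≡⟨ count-pairing (λ x → inColumn j x ∧ ⌊ proj₁ x ≟ a ⌋) ⟩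
    count (λ i → incidence j i ∧ ⌊ i ≟ a ⌋) + count (λ i → not (incidence j i) ∧ ⌊ i ≟ a ⌋)
      ≡⟨ cong₂ _+_ (count-cong (λ i → ∧-comm (incidence j i) ⌊ i ≟ a ⌋))
                   (count-cong (λ i → ∧-comm (not (incidence j i)) ⌊ i ≟ a ⌋)) ⟩
    count (λ i → ⌊ i ≟ a ⌋ ∧ incidence j i) + count (λ i → ⌊ i ≟ a ⌋ ∧ not (incidence j i))
      ≡⟨ count-split (λ i → ⌊ i ≟ a ⌋) (incidence j) ⟨
    count (λ i → ⌊ i ≟ a ⌋)
      ≡⟨ count-≟ a ⟩
    1 ∎

  resolvable : Resolvable tripleArray
  resolvable = record
    { λrrc-integer    = divides (1 + n) e[e-1]≡[λ+1][v-1]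
    ; k               = 2
    ; k-def           = 2e≡v+1
    ; group           = group
    ; group-size      = λ a →
        trans (count-pairing (λ x → ⌊ proj₁ x ≟ a ⌋)) (cong₂ _+_ (count-≟ a) (count-≟ a))
    ; col-transversal = column-transversal
    ; group-rows      = λ x y same-group i → begin
        x ∈ˢ symbols (inRow i)     ≡⟨ ∈ˢ-symbols (inRow i) x ⟩
        i ∉B group x               ≡⟨ cong (i ∉B_) same-group ⟩
        i ∉B group y               ≡⟨ ∈ˢ-symbols (inRow i) y ⟨
        y ∈ˢ symbols (inRow i)     ∎
    }

-- For n = 0 the blocks of a 2-(3,1,0) design may repeat, so the replication
-- number is not determined; the design of singletons is used instead.
regularHadamardDesign : ∀ n → SymmetricDesign (3 + 4 * n) (1 + 2 * n) n →
  Σ[ D ∈ SymmetricDesign (3 + 4 * n) (1 + 2 * n) n ] (∀ y → replication D y ≡ 1 + 2 * n)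
regularHadamardDesign zero    _ = singletonDesign 3 , replication-singleton
regularHadamardDesign (suc n) D = D , replication-hadamard D

resolvableTripleArray : ∀ n → SymmetricDesign (3 + 4 * n) (1 + 2 * n) n →
  Σ (UnorderedTripleArray (3 + 4 * n) (4 + 4 * n) ((3 + 4 * n) + (3 + 4 * n))) Resolvable
resolvableTripleArray n D = tripleArray , resolvable
  where
  open HadamardConstruction n (proj₁ (regularHadamardDesign n D)) (proj₂ (regularHadamardDesign n D))

resolvableTripleArray-cast : ∀ {r c s r′ c′ s′} → r ≡ r′ → c ≡ c′ → s ≡ s′ →
  Σ (UnorderedTripleArray r c s) Resolvable → Σ (UnorderedTripleArray r′ c′ s′) Resolvable
resolvableTripleArray-cast refl refl refl U = U

theorem6 : (m : ℕ) → 1 ≤ m →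
    SymmetricDesign (4 * m ∸ 1) (2 * m ∸ 1) (m ∸ 1) →
    Σ (UnorderedTripleArray (4 * m ∸ 1) (4 * m) (8 * m ∸ 2)) Resolvable
theorem6 zero    () _
theorem6 (suc n) _  D = resolvableTripleArray-cast (sym v≡) (sym c≡) (sym s≡)
  (resolvableTripleArray n (subst₂ (λ v k → SymmetricDesign v k n) v≡ k≡ D))
  where
  c≡ : 4 * suc n ≡ 4 + 4 * n
  c≡ = solve (n ∷ [])
  v≡ : 4 * suc n ∸ 1 ≡ 3 + 4 * n
  v≡ = cong (_∸ 1) c≡
  k≡ : 2 * suc n ∸ 1 ≡ 1 + 2 * n
  k≡ = cong (_∸ 1) (2 * suc n ≡ 2 + 2 * n ∋ solve (n ∷ []))
  s≡ : 8 * suc n ∸ 2 ≡ (3 + 4 * n) + (3 + 4 * n)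
  s≡ = cong (_∸ 2) (8 * suc n ≡ 2 + ((3 + 4 * n) + (3 + 4 * n)) ∋ solve (n ∷ []))
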